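{- Let $K_{n,m}$ be the complete bipartite graph with parts of sizes $n\ge1$ and $m\ge1$. Then $$A(K_{n,m};x)=n\,x^n+m\,x^m+\sum_{k=2}^{n+m}\ \sum_{\substack{i,j>0\\ i+j=k}}\binom{n}{i}\binom{m}{j}x^{\,n+m+\min\{2i-n,\,2j-m\}}.$$
   Context: For a finite simple graph $\Gamma=(V,E)$ of order $N$, a vertex $v$ and $X\subseteq V$, $\delta_X(v)$ is the number of neighbours of $v$ in $X$, $\delta_1$ the maximum degree, $\bar S=V\setminus S$, and $\mathcal{K}=[-\delta_1,\delta_1]\cap\mathbb{Z}$. A nonempty $S\subseteq V$ is a defensive $k$-alliance if $\delta_S(v)\ge\delta_{\bar S}(v)+k$ for all $v\in S$; its exact index of alliance is $k_S=\max\{k\in\mathcal{K}: S \text{ is a defensive } k\text{ -alliance}\}$. The alliance polynomial is $A(\Gamma;x)=\sum_{S} x^{N+k_S}$, the sum over all nonempty $S\subseteq V$ with induced subgraph $\langle S\rangle$ connected. -}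

module Defs where

open import Data.Bool using (Bool; true; false; _∧_; _∨_; not; _xor_; if_then_else_)
open import Data.Nat as ℕ using (ℕ; zero; suc; _<ᵇ_; _⊔_)
open import Data.Nat.Combinatorics using (_C_)
open import Data.Integer as ℤ using (ℤ; +_; -_; _≤ᵇ_; _⊓_)
open import Data.Fin using (Fin; toℕ)
open import Data.List using (List; []; _∷_; map; filter; length; foldr; upTo; allFin; concatMap)
open import Data.Nat.ListAction using (sum)
open import Data.Bool.ListAction using (all; any)
open import Relation.Binary.PropositionalEquality using (_≡_; refl)
open import Relation.Nullary.Decidable using (does)
open import Data.Integer.Properties using () renaming (_≟_ to _≟ℤ_)
open import Data.Bool.Properties using (T?)

record Graph (N : ℕ) : Set where
  field
    adj   : Fin N → Fin N → Bool
    sym   : ∀ u v → adj u v ≡ adj v u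
    irrefl : ∀ v → adj v v ≡ false
open Graph public

VSet : ℕ → Set
VSet N = Fin N → Bool

allSubsets : (N : ℕ) → List (VSet N)
allSubsets zero = (λ ()) ∷ []
allSubsets (suc N) =
  concatMap (λ S → (λ { Fin.zero → false ; (Fin.suc i) → S i })
                 ∷ (λ { Fin.zero → true ; (Fin.suc i) → S i }) ∷ [])
            (allSubsets N)
  where import Data.Fin as Fin

complement : ∀ {N} → VSet N → VSet N
complement S v = not (S v)

nonempty : ∀ {N} → VSet N → Bool
nonempty {N} S = any S (allFin N)

δ : ∀ {N} → Graph N → VSet N → Fin N → ℕ
δ {N} Γ X v = length (filter (λ u → T? (adj Γ v u ∧ X u)) (allFin N))

degree : ∀ {N} → Graph N → Fin N → ℕ
degree Γ v = δ Γ (λ _ → true) v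

δ₁ : ∀ {N} → Graph N → ℕ
δ₁ {N} Γ = foldr _⊔_ 0 (map (degree Γ) (allFin N))

𝒦 : ∀ {N} → Graph N → List ℤ
𝒦 Γ = map (λ i → + i ℤ.- + δ₁ Γ) (upTo (suc (2 ℕ.* δ₁ Γ)))

isDefAlliance : ∀ {N} → Graph N → VSet N → ℤ → Bool
isDefAlliance {N} Γ S k =
  all (λ v → not (S v) ∨ ((+ δ Γ (complement S) v ℤ.+ k) ≤ᵇ + δ Γ S v)) (allFin N)

-- exact index of alliance k_S = max { k ∈ 𝒦 : S is a defensive k-alliance }
-- (the maximum of the filtered list; -δ₁ always belongs to it for nonempty S)
exactIndex : ∀ {N} → Graph N → VSet N → ℤ
exactIndex Γ S =
  foldr ℤ._⊔_ (- + δ₁ Γ) (filter (λ k → T? (isDefAlliance Γ S k)) (𝒦 Γ))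

-- reachability inside S: vertices reachable from v by a walk of length ≤ k
-- all of whose vertices lie in S (v itself is included)
reach : ∀ {N} → Graph N → VSet N → ℕ → Fin N → VSet N
reach Γ S zero v u = S v ∧ S u ∧ does (Data.Fin._≟_ v u)
  where import Data.Fin
reach {N} Γ S (suc k) v u =
  reach Γ S k v u ∨ (S u ∧ any (λ w → reach Γ S k v w ∧ adj Γ w u) (allFin N))

inducedConnected : ∀ {N} → Graph N → VSet N → Bool
inducedConnected {N} Γ S =
  nonempty S ∧
  all (λ u → all (λ w → not (S u ∧ S w) ∨ reach Γ S N u w) (allFin N)) (allFin N)

-- Alliance polynomial A(Γ;x) = Σ_{S nonempty, ⟨S⟩ connected} x^{N + k_S},
-- represented by its coefficient function (exponent ↦ coefficient).
allianceCoeff : ∀ {N} → Graph N → ℤ → ℕ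
allianceCoeff {N} Γ e =
  length (filter (λ S → T? (inducedConnected Γ S ∧ does ((+ N ℤ.+ exactIndex Γ S) ≟ℤ e)))
                 (allSubsets N))

-- Complete bipartite graph K_{n,m}: vertices 0..n-1 form one part,
-- n..n+m-1 the other.

part : ∀ {n m} → Fin (n ℕ.+ m) → Bool
part {n} v = toℕ v <ᵇ n

xor-self : ∀ b → b xor b ≡ false
xor-self true = refl
xor-self false = refl

xor-comm : ∀ a b → a xor b ≡ b xor a
xor-comm true true = refl
xor-comm true false = refl
xor-comm false true = refl
xor-comm false false = refl

K : (n m : ℕ) → Graph (n ℕ.+ m)
K n m = record
  { adj = λ u v → part {n} {m} u xor part {n} {m} v
  ; sym = λ u v → xor-comm (part {n} {m} u) (part {n} {m} v)
  ; irrefl = λ v → xor-self (part {n} {m} v)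
  }

[_≟_]ℤ : ℤ → ℤ → ℕ
[ a ≟ b ]ℤ = if does (a ≟ℤ b) then 1 else 0

-- list [a, a+1, ..., b]  (empty if b < a)
range : ℕ → ℕ → List ℕ
range a b = map (a ℕ.+_) (upTo (suc b ℕ.∸ a))

rhsCoeff : ℕ → ℕ → ℤ → ℕ
rhsCoeff n m e =
  n ℕ.* [ + n ≟ e ]ℤ ℕ.+ m ℕ.* [ + m ≟ e ]ℤ ℕ.+
  sum (map (λ k →
        sum (map (λ i → let j = k ℕ.∸ i in
                    (n C i) ℕ.* (m C j) ℕ.*
                    [ + (n ℕ.+ m) ℤ.+ ((+ (2 ℕ.* i) ℤ.- + n) ⊓ (+ (2 ℕ.* j) ℤ.- + m)) ≟ e ]ℤ)
                 (range 1 (k ℕ.∸ 1))))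
      (range 2 (n ℕ.+ m)))

module Submission where

open import Defs hiding (sym)
open import Function using (_∘_; _⇔_; mk⇔; Equivalence)
import Function.Properties.Equivalence as Eq
open import Data.Bool using (Bool; true; false; _∧_; _∨_; not; _xor_; if_then_else_; T)
open import Data.Bool.Properties using (T?; ∧-comm; ∧-identityʳ; ∧-zeroʳ; ∨-zeroʳ)
open import Data.Nat as ℕ using (ℕ; zero; suc; _+_; _*_; _∸_; _<ᵇ_; _≤_; _<_; _≥_; z≤n; s≤s)
open import Data.Nat.Properties as ℕP using (+-suc; +-assoc; +-comm; +-identityʳ; ≤-pred)
open import Data.Fin as F using (Fin)
import Data.Fin.Properties as FP
open import Data.List using (List; []; _∷_; map; filter; length; foldr; upTo; allFin; concatMap; tabulate; applyUpTo)
open import Data.List.Properties using (map-∘)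
open import Data.Nat.ListAction using (sum)
open import Data.Nat.Combinatorics using (_C_; k>n⇒nCk≡0; nCk+nC[k+1]≡[n+1]C[k+1]; nC1≡n)
open import Data.Bool.ListAction using (all; any)
open import Data.Integer as ℤ using (ℤ; +_; -_; _≤ᵇ_; _⊓_)
import Data.Integer.Properties as ℤP
open import Data.Integer.Properties using () renaming (_≟_ to _≟ℤ_)
open import Data.Integer.Tactic.RingSolver using (solve-∀)
open import Data.List.Membership.Propositional using (_∈_)
open import Data.List.Membership.Propositional.Properties using (∈-map⁺; ∈-upTo⁺; ∈-allFin)
open import Data.List.Relation.Unary.Any using (here; there)
open import Data.Product using (Σ; _×_; _,_; proj₁; proj₂)
open import Data.Empty using (⊥-elim)
open import Relation.Nullary using (¬_; yes; no; does)
open import Relation.Nullary.Decidable using (dec-true)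
open import Relation.Binary.PropositionalEquality
open import Algebra.Properties.CommutativeSemigroup ℕP.+-commutativeSemigroup using (interchange)

-- Let A and B be the parts of K_{n,m} and, for S ⊆ V, a = |S ∩ A|, b = |S ∩ B|.
-- Everything about S entering the alliance polynomial depends only on (a, b):
--   * ⟨S⟩ is connected iff a, b ≥ 1 (any two vertices are at distance ≤ 2
--     inside S) or a + b = 1; a subset of one part spans no edge;
--   * a vertex of S in A has b neighbours in S and m - b outside, so S is a
--     defensive k-alliance iff k ≤ 2b - m (if a ≥ 1) and k ≤ 2a - n (if b ≥ 1),
--     and k_S is the least of these bounds.
-- So the coefficient of x^e is Σ_S contribution(a(S), b(S)), and a sum of this
-- shape over all subsets is Σ_{i,j} C(n,i) C(m,j) contribution(i, j).  The row
-- i = 0 gives m x^m, the column j = 0 gives n x^n, and the block i, j ≥ 1 summed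
-- along the anti-diagonals i + j = k is the double sum of the statement.

𝟙 : Bool → ℕ
𝟙 b = if b then 1 else 0

-- Number of elements of Fin N satisfying p; the recursion follows tabulate.
count : ∀ {N} → (Fin N → Bool) → ℕ
count {zero} p = 0
count {suc N} p = 𝟙 (p F.zero) + count (p ∘ F.suc)

allᶠ : ∀ {N} → (Fin N → Bool) → Bool
allᶠ {zero} p = true
allᶠ {suc N} p = p F.zero ∧ allᶠ (p ∘ F.suc)

length-filter-tabulate : ∀ {N M} (f : Fin N → Fin M) (p : Fin M → Bool) →
  length (filter (λ u → T? (p u)) (tabulate f)) ≡ count (p ∘ f)
length-filter-tabulate {zero} f p = refl
length-filter-tabulate {suc N} f p with p (f F.zero)
... | true = cong suc (length-filter-tabulate (f ∘ F.suc) p)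
... | false = length-filter-tabulate (f ∘ F.suc) p

any-tabulate : ∀ {N M} (f : Fin N → Fin M) (p : Fin M → Bool) →
  any p (tabulate f) ≡ (0 <ᵇ count (p ∘ f))
any-tabulate {zero} f p = refl
any-tabulate {suc N} f p with p (f F.zero)
... | true = refl
... | false = any-tabulate (f ∘ F.suc) p

all-tabulate : ∀ {N M} (f : Fin N → Fin M) (p : Fin M → Bool) →
  all p (tabulate f) ≡ allᶠ (p ∘ f)
all-tabulate {zero} f p = refl
all-tabulate {suc N} f p = cong (p (f F.zero) ∧_) (all-tabulate (f ∘ F.suc) p)

count-cong : ∀ {N} {p q : Fin N → Bool} → (∀ i → p i ≡ q i) → count p ≡ count q
count-cong {zero} e = refl
count-cong {suc N} e = cong₂ (λ a b → 𝟙 a + b) (e F.zero) (count-cong (e ∘ F.suc))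

allᶠ-cong : ∀ {N} {p q : Fin N → Bool} → (∀ i → p i ≡ q i) → allᶠ p ≡ allᶠ q
allᶠ-cong {zero} e = refl
allᶠ-cong {suc N} e = cong₂ _∧_ (e F.zero) (allᶠ-cong (e ∘ F.suc))

count-false : ∀ {N} → count {N} (λ _ → false) ≡ 0
count-false {zero} = refl
count-false {suc N} = count-false {N}

count-true : ∀ {N} → count {N} (λ _ → true) ≡ N
count-true {zero} = refl
count-true {suc N} = cong suc (count-true {N})

count-split : ∀ {N} (q p : Fin N → Bool) →
  count p ≡ count (λ u → q u ∧ p u) + count (λ u → not (q u) ∧ p u)
count-split {zero} q p = refl
count-split {suc N} q p with q F.zero | p F.zero | count-split (q ∘ F.suc) (p ∘ F.suc)
... | true  | true  | ih = cong suc ih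
... | true  | false | ih = ih
... | false | true  | ih = trans (cong suc ih) (sym (+-suc _ _))
... | false | false | ih = ih

count-inside+outside : ∀ {N} (p q : Fin N → Bool) →
  count (λ u → p u ∧ q u) + count (λ u → p u ∧ not (q u)) ≡ count p
count-inside+outside p q = sym (trans (count-split q p)
  (cong₂ _+_ (count-cong (λ u → ∧-comm (q u) (p u))) (count-cong (λ u → ∧-comm (not (q u)) (p u)))))

count-pos : ∀ {N} (p : Fin N → Bool) (u : Fin N) → p u ≡ true → 1 ≤ count p
count-pos p F.zero e rewrite e = s≤s z≤n
count-pos p (F.suc u) e with p F.zero
... | true = s≤s z≤n
... | false = count-pos (p ∘ F.suc) u e

count-witness : ∀ {N} (p : Fin N → Bool) → 1 ≤ count p → Σ (Fin N) λ u → p u ≡ true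
count-witness {suc N} p h with p F.zero in eq
... | true = F.zero , eq
... | false with count-witness (p ∘ F.suc) h
...   | u , pu = F.suc u , pu

count-zero : ∀ {N} (p : Fin N → Bool) → count p ≡ 0 → (u : Fin N) → p u ≡ false
count-zero p e u with p u in eq
... | false = refl
... | true with subst (1 ≤_) e (count-pos p u eq)
...   | ()

count-two : ∀ {N} (p : Fin N → Bool) (u w : Fin N) → p u ≡ true → p w ≡ true → ¬ u ≡ w →
  2 ≤ count p
count-two p F.zero F.zero pu pw ne = ⊥-elim (ne refl)
count-two p F.zero (F.suc w) pu pw ne rewrite pu = s≤s (count-pos (p ∘ F.suc) w pw)
count-two p (F.suc u) F.zero pu pw ne rewrite pw = s≤s (count-pos (p ∘ F.suc) u pu)
count-two p (F.suc u) (F.suc w) pu pw ne with p F.zero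
... | true = ℕP.≤-trans (count-two (p ∘ F.suc) u w pu pw (ne ∘ cong F.suc)) (ℕP.n≤1+n _)
... | false = count-two (p ∘ F.suc) u w pu pw (ne ∘ cong F.suc)

count-one : ∀ {N} (p : Fin N → Bool) → count p ≡ 1 → (u w : Fin N) →
  p u ≡ true → p w ≡ true → u ≡ w
count-one p e u w pu pw with u F.≟ w
... | yes u≡w = u≡w
... | no u≢w with subst (2 ≤_) e (count-two p u w pu pw u≢w)
...   | s≤s ()

count-two-witness : ∀ {N} (p : Fin N → Bool) → 2 ≤ count p →
  Σ (Fin N) λ u → Σ (Fin N) λ w → p u ≡ true × p w ≡ true × ¬ u ≡ w
count-two-witness {suc N} p h with p F.zero in eq
... | true with count-witness (p ∘ F.suc) (≤-pred h)
...   | w , pw = F.zero , F.suc w , eq , pw , λ ()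
count-two-witness {suc N} p h | false with count-two-witness (p ∘ F.suc) h
...   | u , w , pu , pw , u≢w = F.suc u , F.suc w , pu , pw , u≢w ∘ FP.suc-injective

1≤⇒0<ᵇ : ∀ {c} → 1 ≤ c → (0 <ᵇ c) ≡ true
1≤⇒0<ᵇ (s≤s _) = refl

0<ᵇ⇒1≤ : ∀ {c} → (0 <ᵇ c) ≡ true → 1 ≤ c
0<ᵇ⇒1≤ {suc c} _ = s≤s z≤n

allᶠ-by-cases : ∀ {N} (p q : Fin N → Bool) (C : Bool → Bool) →
  allᶠ (λ v → not (p v) ∨ C (q v)) ≡
  (not (0 <ᵇ count (λ v → q v ∧ p v)) ∨ C true) ∧ (not (0 <ᵇ count (λ v → not (q v) ∧ p v)) ∨ C false)
allᶠ-by-cases {zero} p q C = refl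
allᶠ-by-cases {suc N} p q C with p F.zero | q F.zero | allᶠ-by-cases (p ∘ F.suc) (q ∘ F.suc) C
... | false | true  | ih = ih
... | false | false | ih = ih
... | true  | true  | ih = trans (cong (C true ∧_) ih) (absorb (C true) _ _)
  where
  absorb : ∀ a x z → a ∧ ((not x ∨ a) ∧ z) ≡ a ∧ z
  absorb false x z = refl
  absorb true x z rewrite ∨-zeroʳ (not x) = refl
... | true  | false | ih = trans (cong (C false ∧_) ih) (absorb (C false) _ _)
  where
  absorb : ∀ a w y → a ∧ (w ∧ (not y ∨ a)) ≡ w ∧ a
  absorb false w y = sym (∧-zeroʳ w)
  absorb true w y rewrite ∨-zeroʳ (not y) = refl

any-intro : ∀ {N} (p : Fin N → Bool) (u : Fin N) → p u ≡ true → any p (allFin N) ≡ true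
any-intro p u pu = trans (any-tabulate (λ i → i) p) (1≤⇒0<ᵇ (count-pos p u pu))

any-witness : ∀ {N} (p : Fin N → Bool) → any p (allFin N) ≡ true → Σ (Fin N) λ u → p u ≡ true
any-witness p e = count-witness p (0<ᵇ⇒1≤ (trans (sym (any-tabulate (λ i → i) p)) e))

all-intro : ∀ {N} (p : Fin N → Bool) → (∀ u → p u ≡ true) → all p (allFin N) ≡ true
all-intro p h = trans (all-tabulate (λ i → i) p) (allᶠ-intro p h)
  where
  allᶠ-intro : ∀ {N} (p : Fin N → Bool) → (∀ u → p u ≡ true) → allᶠ p ≡ true
  allᶠ-intro {zero} p h = refl
  allᶠ-intro {suc N} p h rewrite h F.zero = allᶠ-intro (p ∘ F.suc) (h ∘ F.suc)

all-elim : ∀ {N} (p : Fin N → Bool) → all p (allFin N) ≡ true → ∀ u → p u ≡ true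
all-elim p e = allᶠ-elim p (trans (sym (all-tabulate (λ i → i) p)) e)
  where
  allᶠ-elim : ∀ {N} (p : Fin N → Bool) → allᶠ p ≡ true → ∀ u → p u ≡ true
  allᶠ-elim p e F.zero with p F.zero | e
  ... | true | _ = refl
  allᶠ-elim p e (F.suc u) with p F.zero | e
  ... | true | e′ = allᶠ-elim (p ∘ F.suc) e′ u

length-filter : ∀ {A : Set} (P : A → Bool) (xs : List A) →
  length (filter (λ x → T? (P x)) xs) ≡ sum (map (𝟙 ∘ P) xs)
length-filter P [] = refl
length-filter P (x ∷ xs) with P x
... | true = cong suc (length-filter P xs)
... | false = length-filter P xs

sum-map-cong : ∀ {A : Set} {f g : A → ℕ} (xs : List A) → (∀ x → f x ≡ g x) →
  sum (map f xs) ≡ sum (map g xs)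
sum-map-cong [] e = refl
sum-map-cong (x ∷ xs) e = cong₂ _+_ (e x) (sum-map-cong xs e)

sum-map-+ : ∀ {A : Set} (f g : A → ℕ) (xs : List A) →
  sum (map (λ x → f x + g x) xs) ≡ sum (map f xs) + sum (map g xs)
sum-map-+ f g [] = refl
sum-map-+ f g (x ∷ xs) rewrite sum-map-+ f g xs = interchange (f x) (g x) _ _

sum-concatMap-pair : ∀ {A B : Set} (f : B → ℕ) (a b : A → B) (xs : List A) →
  sum (map f (concatMap (λ x → a x ∷ b x ∷ []) xs)) ≡ sum (map (λ x → f (a x) + f (b x)) xs)
sum-concatMap-pair f a b [] = refl
sum-concatMap-pair f a b (x ∷ xs) =
  trans (sym (+-assoc (f (a x)) (f (b x)) _)) (cong (_+_ (f (a x) + f (b x))) (sum-concatMap-pair f a b xs))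

sumBelow : ℕ → (ℕ → ℕ) → ℕ
sumBelow zero f = 0
sumBelow (suc a) f = f 0 + sumBelow a (f ∘ suc)

syntax sumBelow a (λ i → f) = ∑[ i < a ] f

sumBelow-cong : ∀ a {f g : ℕ → ℕ} → (∀ i → i < a → f i ≡ g i) → sumBelow a f ≡ sumBelow a g
sumBelow-cong zero e = refl
sumBelow-cong (suc a) e = cong₂ _+_ (e 0 (s≤s z≤n)) (sumBelow-cong a (λ i i<a → e (suc i) (s≤s i<a)))

sumBelow-zero : ∀ a {f : ℕ → ℕ} → (∀ i → i < a → f i ≡ 0) → sumBelow a f ≡ 0
sumBelow-zero zero e = refl
sumBelow-zero (suc a) e rewrite e 0 (s≤s z≤n) = sumBelow-zero a (λ i i<a → e (suc i) (s≤s i<a))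

sumBelow-+ : ∀ a (f g : ℕ → ℕ) → ∑[ i < a ] (f i + g i) ≡ sumBelow a f + sumBelow a g
sumBelow-+ zero f g = refl
sumBelow-+ (suc a) f g rewrite sumBelow-+ a (f ∘ suc) (g ∘ suc) = interchange (f 0) (g 0) _ _

sumBelow-*ˡ : ∀ a c (f : ℕ → ℕ) → c * sumBelow a f ≡ ∑[ i < a ] (c * f i)
sumBelow-*ˡ zero c f = ℕP.*-zeroʳ c
sumBelow-*ˡ (suc a) c f = trans (ℕP.*-distribˡ-+ c (f 0) _) (cong (_+_ (c * f 0)) (sumBelow-*ˡ a c (f ∘ suc)))

sumBelow-last : ∀ a (f : ℕ → ℕ) → sumBelow (suc a) f ≡ sumBelow a f + f a
sumBelow-last zero f = +-comm (f 0) 0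
sumBelow-last (suc a) f rewrite sumBelow-last a (f ∘ suc) = sym (+-assoc (f 0) _ _)

sumBelow-split : ∀ b c (f : ℕ → ℕ) → sumBelow (b + c) f ≡ sumBelow b f + ∑[ i < c ] f (b + i)
sumBelow-split zero c f = refl
sumBelow-split (suc b) c f rewrite sumBelow-split b c (f ∘ suc) = sym (+-assoc (f 0) _ _)

sumBelow-truncate : ∀ a b (f : ℕ → ℕ) → b ≤ a → (∀ i → b ≤ i → f i ≡ 0) → sumBelow a f ≡ sumBelow b f
sumBelow-truncate a b f b≤a vanish with ℕP.m≤n⇒∃[o]m+o≡n b≤a
... | c , refl = begin
    sumBelow (b + c) f                      ≡⟨ sumBelow-split b c f ⟩
    sumBelow b f + ∑[ i < c ] f (b + i)     ≡⟨ cong (_+_ (sumBelow b f)) (sumBelow-zero c (λ i _ → vanish (b + i) (ℕP.m≤m+n b i))) ⟩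
    sumBelow b f + 0                        ≡⟨ +-identityʳ _ ⟩
    sumBelow b f                            ∎
  where open ≡-Reasoning

sum-applyUpTo : ∀ (f h : ℕ → ℕ) k → sum (map f (applyUpTo h k)) ≡ ∑[ i < k ] f (h i)
sum-applyUpTo f h zero = refl
sum-applyUpTo f h (suc k) = cong (_+_ (f (h 0))) (sum-applyUpTo f (h ∘ suc) k)

antidiagonals : ∀ K (V : ℕ → ℕ → ℕ) →
  ∑[ k < K ] ∑[ i < suc k ] V i (k ∸ i) ≡ ∑[ i < K ] sumBelow (K ∸ i) (V i)
antidiagonals zero V = refl
antidiagonals (suc K) V = begin
    ∑[ k < suc K ] ∑[ i < suc k ] V i (k ∸ i)
  ≡⟨ sumBelow-last K _ ⟩
    ∑[ k < K ] ∑[ i < suc k ] V i (k ∸ i) + ∑[ i < suc K ] V i (K ∸ i)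
  ≡⟨ cong₂ _+_ (antidiagonals K V) (sumBelow-last K _) ⟩
    ∑[ i < K ] sumBelow (K ∸ i) (V i) + (∑[ i < K ] V i (K ∸ i) + V K (K ∸ K))
  ≡⟨ sym (+-assoc (∑[ i < K ] sumBelow (K ∸ i) (V i)) _ _) ⟩
    (∑[ i < K ] sumBelow (K ∸ i) (V i) + ∑[ i < K ] V i (K ∸ i)) + V K (K ∸ K)
  ≡⟨ cong₂ _+_ (sym (sumBelow-+ K _ _)) (cong (V K) (ℕP.n∸n≡0 K)) ⟩
    ∑[ i < K ] (sumBelow (K ∸ i) (V i) + V i (K ∸ i)) + V K 0
  ≡⟨ cong₂ _+_ (sumBelow-cong K (λ i i<K → sym (longer-row i i<K))) (sym (last-row K)) ⟩
    ∑[ i < K ] sumBelow (suc K ∸ i) (V i) + sumBelow (suc K ∸ K) (V K)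
  ≡⟨ sym (sumBelow-last K _) ⟩
    ∑[ i < suc K ] sumBelow (suc K ∸ i) (V i)
  ∎
  where
  open ≡-Reasoning
  longer-row : ∀ i → i < K → sumBelow (suc K ∸ i) (V i) ≡ sumBelow (K ∸ i) (V i) + V i (K ∸ i)
  longer-row i i<K = trans (cong (λ l → sumBelow l (V i)) (ℕP.+-∸-assoc 1 (ℕP.<⇒≤ i<K))) (sumBelow-last (K ∸ i) (V i))
  last-row : ∀ K → sumBelow (suc K ∸ K) (V K) ≡ V K 0
  last-row K rewrite ℕP.m+n∸n≡m 1 K = +-identityʳ (V K 0)

-- binomialSum n G is the sum of G |T| over all subsets T of an n-set,
-- computed by the same recursion as allSubsets (a new element is either
-- left out or added).
binomialSum : ℕ → (ℕ → ℕ) → ℕ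
binomialSum zero G = G 0
binomialSum (suc n) G = binomialSum n G + binomialSum n (G ∘ suc)

binomialSum-closed : ∀ n (G : ℕ → ℕ) → binomialSum n G ≡ ∑[ i < suc n ] ((n C i) * G i)
binomialSum-closed zero G = trans (sym (+-identityʳ (G 0))) (cong (_+ 0) (sym (+-identityʳ (G 0))))
binomialSum-closed (suc n) G = begin
    binomialSum n G + binomialSum n (G ∘ suc)
  ≡⟨ cong₂ _+_ (binomialSum-closed n G) (binomialSum-closed n (G ∘ suc)) ⟩
    ((G 0 + 0) + ∑[ i < n ] ((n C suc i) * G (suc i))) + ∑[ i < suc n ] ((n C i) * G (suc i))
  ≡⟨ cong (λ z → (z + ∑[ i < n ] ((n C suc i) * G (suc i))) + ∑[ i < suc n ] ((n C i) * G (suc i))) (+-identityʳ (G 0)) ⟩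
    (G 0 + ∑[ i < n ] ((n C suc i) * G (suc i))) + ∑[ i < suc n ] ((n C i) * G (suc i))
  ≡⟨ cong (λ z → (G 0 + z) + ∑[ i < suc n ] ((n C i) * G (suc i))) top-term-vanishes ⟩
    (G 0 + ∑[ i < suc n ] ((n C suc i) * G (suc i))) + ∑[ i < suc n ] ((n C i) * G (suc i))
  ≡⟨ +-assoc (G 0) _ _ ⟩
    G 0 + (∑[ i < suc n ] ((n C suc i) * G (suc i)) + ∑[ i < suc n ] ((n C i) * G (suc i)))
  ≡⟨ cong (_+_ (G 0)) (sym (sumBelow-+ (suc n) (λ i → (n C suc i) * G (suc i)) (λ i → (n C i) * G (suc i)))) ⟩
    G 0 + ∑[ i < suc n ] ((n C suc i) * G (suc i) + (n C i) * G (suc i))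
  ≡⟨ cong (_+_ (G 0)) (sumBelow-cong (suc n) (λ i _ → pascal i)) ⟩
    G 0 + ∑[ i < suc n ] ((suc n C suc i) * G (suc i))
  ≡⟨ cong (_+ ∑[ i < suc n ] ((suc n C suc i) * G (suc i))) (sym (+-identityʳ (G 0))) ⟩
    ∑[ i < suc (suc n) ] ((suc n C i) * G i)
  ∎
  where
  open ≡-Reasoning
  top-term-vanishes : ∑[ i < n ] ((n C suc i) * G (suc i)) ≡ ∑[ i < suc n ] ((n C suc i) * G (suc i))
  top-term-vanishes = sym (begin
      ∑[ i < suc n ] ((n C suc i) * G (suc i))         ≡⟨ sumBelow-last n _ ⟩
      ∑[ i < n ] ((n C suc i) * G (suc i)) + (n C suc n) * G (suc n)
        ≡⟨ cong (λ c → ∑[ i < n ] ((n C suc i) * G (suc i)) + c * G (suc n)) (k>n⇒nCk≡0 (ℕP.n<1+n n)) ⟩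
      ∑[ i < n ] ((n C suc i) * G (suc i)) + 0         ≡⟨ +-identityʳ _ ⟩
      ∑[ i < n ] ((n C suc i) * G (suc i))             ∎)
  pascal : ∀ i → (n C suc i) * G (suc i) + (n C i) * G (suc i) ≡ (suc n C suc i) * G (suc i)
  pascal i = trans (sym (ℕP.*-distribʳ-+ (G (suc i)) (n C suc i) (n C i)))
                   (cong (_* G (suc i)) (trans (+-comm (n C suc i) (n C i)) (nCk+nC[k+1]≡[n+1]C[k+1] n i)))

sum-subsets : ∀ m (h : ℕ → ℕ) → sum (map (h ∘ count) (allSubsets m)) ≡ binomialSum m h
sum-subsets zero h = +-identityʳ (h 0)
sum-subsets (suc m) h =
  trans (sum-concatMap-pair (h ∘ count) _ _ (allSubsets m))
    (trans (sum-map-+ (h ∘ count) (h ∘ suc ∘ count) (allSubsets m))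
      (cong₂ _+_ (sum-subsets m h) (sum-subsets m (h ∘ suc))))

sizeA sizeB : ∀ n m → VSet (n + m) → ℕ
sizeA n m S = count (λ u → part {n} {m} u ∧ S u)
sizeB n m S = count (λ u → not (part {n} {m} u) ∧ S u)

-- Summing a function of (|S ∩ A|, |S ∩ B|) over all subsets S: a subset of
-- V is an arbitrary choice of a subset of A and a subset of B.
sum-subsets-by-parts : ∀ n m (g : ℕ → ℕ → ℕ) →
  sum (map (λ S → g (sizeA n m S) (sizeB n m S)) (allSubsets (n + m))) ≡ binomialSum n (λ i → binomialSum m (g i))
sum-subsets-by-parts zero m g =
  trans (sum-map-cong (allSubsets m) (λ S → cong (λ a → g a (count S)) (count-false {m})))
        (sum-subsets m (g 0))
sum-subsets-by-parts (suc n) m g =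
  trans (sum-concatMap-pair (λ S → g (sizeA (suc n) m S) (sizeB (suc n) m S)) _ _ (allSubsets (n + m)))
    (trans (sum-map-+ (λ S → g (sizeA n m S) (sizeB n m S)) (λ S → g (suc (sizeA n m S)) (sizeB n m S)) (allSubsets (n + m)))
      (cong₂ _+_ (sum-subsets-by-parts n m g) (sum-subsets-by-parts n m (g ∘ suc))))

T⇒≡true : ∀ {b} → T b → b ≡ true
T⇒≡true {true} _ = refl

≡true⇒T : ∀ {b} → b ≡ true → T b
≡true⇒T refl = _

∧-elim : ∀ a {b} → a ∧ b ≡ true → a ≡ true × b ≡ true
∧-elim true {true} _ = refl , refl

-- The margin 2c - M: a vertex with c neighbours inside S out of M in total
-- has c - (M - c) = 2c - M more neighbours inside S than outside.
margin : ℕ → ℕ → ℤ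
margin c M = + (2 * c) ℤ.- + M

+[2*c]≡+c+c : ∀ c → + (2 * c) ≡ + c ℤ.+ + c
+[2*c]≡+c+c c = trans (cong (λ x → + (c + x)) (+-identityʳ c)) (ℤP.pos-+ c c)

margin-iff : ∀ c d M k → c + d ≡ M → ((+ d ℤ.+ k) ≤ᵇ + c) ≡ true ⇔ k ℤ.≤ margin c M
margin-iff c d M k refl = mk⇔
    (λ h → subst₂ ℤ._≤_ (cancel (+ d) k) (trans (cong (ℤ._+_ (- + d)) (sym d+margin≡c)) (cancel (+ d) (margin c (c + d))))
             (ℤP.+-monoʳ-≤ (- + d) (ℤP.≤ᵇ⇒≤ (≡true⇒T h))))
    (λ h → T⇒≡true (ℤP.≤⇒≤ᵇ (subst (+ d ℤ.+ k ℤ.≤_) d+margin≡c (ℤP.+-monoʳ-≤ (+ d) h))))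
  where
  d+margin≡c : + d ℤ.+ margin c (c + d) ≡ + c
  d+margin≡c = trans (cong₂ (λ a b → + d ℤ.+ (a ℤ.- b)) (+[2*c]≡+c+c c) (ℤP.pos-+ c d)) (solve (+ c) (+ d))
    where
    solve : ∀ (c d : ℤ) → d ℤ.+ ((c ℤ.+ c) ℤ.- (c ℤ.+ d)) ≡ c
    solve = solve-∀
  cancel : ∀ (d x : ℤ) → - d ℤ.+ (d ℤ.+ x) ≡ x
  cancel = solve-∀

margin-bounds : ∀ c M D → c ℕ.≤ M → M ℕ.≤ D → (- + D ℤ.≤ margin c M) × (margin c M ℤ.≤ + D)
margin-bounds c M D c≤M M≤D = lower , upper
  where
  lower : - + D ℤ.≤ margin c M
  lower = ℤP.≤-trans (ℤP.neg-mono-≤ (ℤ.+≤+ M≤D))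
            (subst (ℤ._≤ margin c M) (ℤP.+-identityˡ (- + M)) (ℤP.+-monoˡ-≤ (- + M) (ℤ.+≤+ z≤n)))
  upper : margin c M ℤ.≤ + D
  upper = ℤP.≤-trans (subst (margin c M ℤ.≤_) (trans (cong (ℤ._- + M) (+[2*c]≡+c+c M)) (solve (+ M)))
                        (ℤP.+-monoˡ-≤ (- + M) (ℤ.+≤+ (ℕP.*-monoʳ-≤ 2 c≤M))))
            (ℤ.+≤+ M≤D)
    where
    solve : ∀ (a : ℤ) → (a ℤ.+ a) ℤ.- a ≡ a
    solve = solve-∀

maximum-filter : ∀ (P : ℤ → Bool) (xs : List ℤ) d x → (∀ y → P y ≡ true → y ℤ.≤ x) →
  x ∈ xs → P x ≡ true → d ℤ.≤ x → foldr ℤ._⊔_ d (filter (λ k → T? (P k)) xs) ≡ x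
maximum-filter P xs d x upper x∈xs Px d≤x = ℤP.≤-antisym (bounded xs) (attained xs x∈xs)
  where
  bounded : ∀ xs → foldr ℤ._⊔_ d (filter (λ k → T? (P k)) xs) ℤ.≤ x
  bounded [] = d≤x
  bounded (y ∷ xs) with P y in eq
  ... | true = ℤP.⊔-lub (upper y eq) (bounded xs)
  ... | false = bounded xs
  attained : ∀ xs → x ∈ xs → x ℤ.≤ foldr ℤ._⊔_ d (filter (λ k → T? (P k)) xs)
  attained (y ∷ xs) (here refl) rewrite Px = ℤP.i≤i⊔j x _
  attained (y ∷ xs) (there x∈xs) with P y
  ... | true = ℤP.≤-trans (attained xs x∈xs) (ℤP.i≤j⊔i y _)
  ... | false = attained xs x∈xs

∈-interval : ∀ D x → - + D ℤ.≤ x → x ℤ.≤ + D → x ∈ map (λ i → + i ℤ.- + D) (upTo (suc (2 * D)))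
∈-interval D x lower upper =
  subst (_∈ map (λ i → + i ℤ.- + D) (upTo (suc (2 * D)))) shift-back
        (∈-map⁺ (λ i → + i ℤ.- + D) (∈-upTo⁺ (s≤s i≤2D)))
  where
  shifted : ℤ
  shifted = x ℤ.+ + D
  0≤shifted : + 0 ℤ.≤ shifted
  0≤shifted = subst (ℤ._≤ shifted) (ℤP.+-inverseˡ (+ D)) (ℤP.+-monoˡ-≤ (+ D) lower)
  i : ℕ
  i = ℤ.∣ shifted ∣
  +i≡shifted : + i ≡ shifted
  +i≡shifted = ℤP.0≤i⇒+∣i∣≡i 0≤shifted
  shift-back : + i ℤ.- + D ≡ x
  shift-back = trans (cong (ℤ._- + D) +i≡shifted) (solve x (+ D))
    where
    solve : ∀ (x d : ℤ) → (x ℤ.+ d) ℤ.- d ≡ x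
    solve = solve-∀
  i≤2D : i ℕ.≤ 2 * D
  i≤2D = ℤP.drop‿+≤+ (subst₂ ℤ._≤_ (sym +i≡shifted) (sym (+[2*c]≡+c+c D)) (ℤP.+-monoˡ-≤ (+ D) upper))

exactIndex-unique : ∀ {N} (Γ : Graph N) (S : VSet N) (kₛ : ℤ) →
  (∀ k → isDefAlliance Γ S k ≡ true ⇔ k ℤ.≤ kₛ) → - + δ₁ Γ ℤ.≤ kₛ → kₛ ℤ.≤ + δ₁ Γ →
  exactIndex Γ S ≡ kₛ
exactIndex-unique Γ S kₛ alliance⇔ lower upper =
  maximum-filter (isDefAlliance Γ S) (𝒦 Γ) (- + δ₁ Γ) kₛ
    (λ k → Equivalence.to (alliance⇔ k)) (∈-interval (δ₁ Γ) kₛ lower upper)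
    (Equivalence.from (alliance⇔ kₛ) ℤP.≤-refl) lower

degree≤δ₁ : ∀ {N} (Γ : Graph N) v → degree Γ v ℕ.≤ δ₁ Γ
degree≤δ₁ Γ v = ≤-foldr-⊔ (∈-map⁺ (degree Γ) (∈-allFin v))
  where
  ≤-foldr-⊔ : ∀ {x} {xs : List ℕ} → x ∈ xs → x ℕ.≤ foldr ℕ._⊔_ 0 xs
  ≤-foldr-⊔ {x} (here refl) = ℕP.m≤m⊔n x _
  ≤-foldr-⊔ {x} {y ∷ xs} (there x∈xs) = ℕP.≤-trans (≤-foldr-⊔ x∈xs) (ℕP.m≤n⊔m y _)

module Walks {N} (Γ : Graph N) (S : VSet N) where

  reach-refl : ∀ v → S v ≡ true → reach Γ S 0 v v ≡ true
  reach-refl v sv rewrite sv = dec-true (v F.≟ v) refl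

  reach-suc : ∀ k v u → reach Γ S k v u ≡ true → reach Γ S (suc k) v u ≡ true
  reach-suc k v u r rewrite r = refl

  reach-mono : ∀ {k l} v u → k ℕ.≤ l → reach Γ S k v u ≡ true → reach Γ S l v u ≡ true
  reach-mono {k} v u k≤l r with ℕP.m≤n⇒∃[o]m+o≡n k≤l
  ... | j , refl = subst (λ l → reach Γ S l v u ≡ true) (+-comm j k) (extend j)
    where
    extend : ∀ j → reach Γ S (j + k) v u ≡ true
    extend zero = r
    extend (suc j) = reach-suc (j + k) v u (extend j)

  reach-step : ∀ k v x y → reach Γ S k v x ≡ true → S y ≡ true → adj Γ x y ≡ true →
    reach Γ S (suc k) v y ≡ true
  reach-step k v x y rx sy xy
    rewrite sy | any-intro (λ w → reach Γ S k v w ∧ adj Γ w y) x (cong₂ _∧_ rx xy) = ∨-zeroʳ _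

  reach-⊆ : ∀ k v u → reach Γ S k v u ≡ true → S u ≡ true
  reach-⊆ zero v u r = proj₁ (∧-elim (S u) (proj₂ (∧-elim (S v) r)))
  reach-⊆ (suc k) v u r with reach Γ S k v u in rk
  ... | true = reach-⊆ k v u rk
  ... | false = proj₁ (∧-elim (S u) r)

  Independent : Set
  Independent = ∀ u w → S u ≡ true → S w ≡ true → adj Γ u w ≡ false

  independent-reach : Independent → ∀ k v u → reach Γ S k v u ≡ true → v ≡ u
  independent-reach indep zero v u r with v F.≟ u | proj₂ (∧-elim (S u) (proj₂ (∧-elim (S v) r)))
  ... | yes v≡u | _ = v≡u
  ... | no _ | ()
  independent-reach indep (suc k) v u r with reach Γ S k v u in rk
  ... | true = independent-reach indep k v u rk
  ... | false with ∧-elim (S u) r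
  ...   | su , via with any-witness (λ w → reach Γ S k v w ∧ adj Γ w u) via
  ...     | w , rw∧wu with ∧-elim (reach Γ S k v w) rw∧wu
  ...       | rw , wu with independent-reach indep k v w rw
  ...         | refl with trans (sym wu) (indep v u (reach-⊆ k v v rw) su)
  ...           | ()

module Connectivity {N} (Γ : Graph N) (S : VSet N) where
  open Walks Γ S

  pairwiseJoined : Bool
  pairwiseJoined = all (λ u → all (λ w → not (S u ∧ S w) ∨ reach Γ S N u w) (allFin N)) (allFin N)

  nonempty-count : nonempty S ≡ (0 <ᵇ count S)
  nonempty-count = any-tabulate (λ i → i) S

  connected-intro : 1 ≤ count S → (∀ u w → S u ≡ true → S w ≡ true → reach Γ S N u w ≡ true) →
    inducedConnected Γ S ≡ true
  connected-intro inhabited joined =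
    cong₂ _∧_ (trans nonempty-count (1≤⇒0<ᵇ inhabited))
      (all-intro _ (λ u → all-intro _ (λ w → pair-intro (S u) (S w) (joined u w))))
    where
    pair-intro : ∀ a b {R} → (a ≡ true → b ≡ true → R ≡ true) → not (a ∧ b) ∨ R ≡ true
    pair-intro true true h = h refl refl
    pair-intro true false h = refl
    pair-intro false b h = refl

  connected-elim : inducedConnected Γ S ≡ true → ∀ u w → S u ≡ true → S w ≡ true →
    reach Γ S N u w ≡ true
  connected-elim connected u w su sw =
    pair-elim (all-elim _ (all-elim _ (proj₂ (∧-elim (nonempty S) connected)) u) w) su sw
    where
    pair-elim : ∀ {a b R} → not (a ∧ b) ∨ R ≡ true → a ≡ true → b ≡ true → R ≡ true
    pair-elim r refl refl = r

  empty-disconnected : count S ≡ 0 → inducedConnected Γ S ≡ false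
  empty-disconnected empty = cong (_∧ pairwiseJoined) (trans nonempty-count (cong (0 <ᵇ_) empty))

  singleton-connected : count S ≡ 1 → inducedConnected Γ S ≡ true
  singleton-connected single = connected-intro (ℕP.≤-reflexive (sym single)) joined
    where
    joined : ∀ u w → S u ≡ true → S w ≡ true → reach Γ S N u w ≡ true
    joined u w su sw with count-one S single u w su sw
    ... | refl = reach-mono {0} {N} u u z≤n (reach-refl u su)

  independent-disconnected : Independent → 2 ≤ count S → inducedConnected Γ S ≡ false
  independent-disconnected indep two with inducedConnected Γ S in connected
  ... | false = refl
  ... | true with count-two-witness S two
  ...   | u , w , su , sw , u≢w = ⊥-elim (u≢w (independent-reach indep N u w (connected-elim connected u w su sw)))

count-partA : ∀ n m → count (part {n} {m}) ≡ n
count-partA zero m = count-false {m}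
count-partA (suc n) m = cong suc (count-partA n m)

count-partB : ∀ n m → count (λ u → not (part {n} {m} u)) ≡ m
count-partB zero m = count-true {m}
count-partB (suc n) m = count-partB n m

guard-⇔ : ∀ c X {P : Set} → X ≡ true ⇔ P → (not (0 <ᵇ c) ∨ X) ≡ true ⇔ (1 ≤ c → P)
guard-⇔ zero X X⇔P = mk⇔ (λ _ ()) (λ _ → refl)
guard-⇔ (suc c) X X⇔P = mk⇔ (λ x _ → Equivalence.to X⇔P x) (λ f → Equivalence.from X⇔P (f (s≤s z≤n)))

∧-⇔ : ∀ a b {P Q : Set} → a ≡ true ⇔ P → b ≡ true ⇔ Q → a ∧ b ≡ true ⇔ (P × Q)
∧-⇔ a b a⇔P b⇔Q = mk⇔
  (λ ab → let (ta , tb) = ∧-elim a ab in Equivalence.to a⇔P ta , Equivalence.to b⇔Q tb)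
  (λ (p , q) → cong₂ _∧_ (Equivalence.from a⇔P p) (Equivalence.from b⇔Q q))

not-true : ∀ {b} → not b ≡ true → b ≡ false
not-true {false} _ = refl

-- The contribution to the coefficient of x^e of a subset with a vertices in
-- the first part and b in the second (the clause order keeps the case
-- a, b ≥ 1 computing for variable a, b).
contribution : ℕ → ℕ → ℤ → ℕ → ℕ → ℕ
contribution n m e zero (suc zero) = [ + m ≟ e ]ℤ
contribution n m e (suc a) (suc b) = [ + (n + m) ℤ.+ (margin (suc a) n ⊓ margin (suc b) m) ≟ e ]ℤ
contribution n m e (suc zero) zero = [ + n ≟ e ]ℤ
contribution n m e _ _ = 0

module Bipartite (n m : ℕ) where

  Γ : Graph (n + m)
  Γ = K n m

  inA : Fin (n + m) → Bool
  inA = part {n} {m}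

  #A #B : VSet (n + m) → ℕ
  #A = sizeA n m
  #B = sizeB n m

  -- For a vertex of part b (true: A, false: B), its neighbours in X are the
  -- vertices of X in the opposite part.
  across : Bool → VSet (n + m) → ℕ
  across b X = count (λ u → (b xor inA u) ∧ X u)

  δ-K : ∀ X v → δ Γ X v ≡ across (inA v) X
  δ-K X v = length-filter-tabulate (λ i → i) (λ u → adj Γ v u ∧ X u)

  opposite : Bool → ℕ
  opposite b = if b then m else n

  opposite-size : ∀ b → count (λ u → b xor inA u) ≡ opposite b
  opposite-size true = count-partB n m
  opposite-size false = count-partA n m

  across-split : ∀ b X → across b X + across b (complement X) ≡ opposite b
  across-split b X = trans (count-inside+outside (λ u → b xor inA u) X) (opposite-size b)

  degree-K : ∀ v → degree Γ v ≡ opposite (inA v)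
  degree-K v = trans (δ-K _ v) (trans (count-cong (λ u → ∧-identityʳ (inA v xor inA u))) (opposite-size (inA v)))

  count≡#A+#B : ∀ S → count S ≡ #A S + #B S
  count≡#A+#B S = count-split inA S

  #A≤n : ∀ S → #A S ℕ.≤ n
  #A≤n S = subst (#A S ℕ.≤_) (across-split false S) (ℕP.m≤m+n _ _)

  #B≤m : ∀ S → #B S ℕ.≤ m
  #B≤m S = subst (#B S ℕ.≤_) (across-split true S) (ℕP.m≤m+n _ _)

  meets-A⇒m≤δ₁ : ∀ S → 1 ≤ #A S → m ℕ.≤ δ₁ Γ
  meets-A⇒m≤δ₁ S meets with count-witness (λ u → inA u ∧ S u) meets
  ... | v , v∈S∩A = subst (ℕ._≤ δ₁ Γ) (trans (degree-K v) (cong opposite (proj₁ (∧-elim (inA v) v∈S∩A)))) (degree≤δ₁ Γ v)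

  meets-B⇒n≤δ₁ : ∀ S → 1 ≤ #B S → n ℕ.≤ δ₁ Γ
  meets-B⇒n≤δ₁ S meets with count-witness (λ u → not (inA u) ∧ S u) meets
  ... | v , v∈S∩B = subst (ℕ._≤ δ₁ Γ) (trans (degree-K v) (cong opposite (not-true (proj₁ (∧-elim (not (inA v)) v∈S∩B))))) (degree≤δ₁ Γ v)

  -- The defensive condition at a vertex of part b depends only on b.
  condition : VSet (n + m) → ℤ → Bool → Bool
  condition S k b = (+ across b (complement S) ℤ.+ k) ≤ᵇ + across b S

  isDefAlliance-K : ∀ S k → isDefAlliance Γ S k ≡
    (not (0 <ᵇ #A S) ∨ condition S k true) ∧ (not (0 <ᵇ #B S) ∨ condition S k false)
  isDefAlliance-K S k =
    trans (all-tabulate (λ i → i) (λ v → not (S v) ∨ ((+ δ Γ (complement S) v ℤ.+ k) ≤ᵇ + δ Γ S v)))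
      (trans (allᶠ-cong (λ v → cong₂ (λ d d′ → not (S v) ∨ ((+ d ℤ.+ k) ≤ᵇ + d′)) (δ-K (complement S) v) (δ-K S v)))
             (allᶠ-by-cases S inA (condition S k)))

  alliance-K : ∀ S k → isDefAlliance Γ S k ≡ true ⇔
    ((1 ≤ #A S → k ℤ.≤ margin (#B S) m) × (1 ≤ #B S → k ℤ.≤ margin (#A S) n))
  alliance-K S k = subst (λ b → b ≡ true ⇔ ((1 ≤ #A S → k ℤ.≤ margin (#B S) m) × (1 ≤ #B S → k ℤ.≤ margin (#A S) n)))
                         (sym (isDefAlliance-K S k))
    (∧-⇔ (not (0 <ᵇ #A S) ∨ condition S k true) (not (0 <ᵇ #B S) ∨ condition S k false)
         (guard-⇔ (#A S) (condition S k true) (margin-iff (#B S) _ m k (across-split true S)))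
         (guard-⇔ (#B S) (condition S k false) (margin-iff (#A S) _ n k (across-split false S))))

  InRange : ℤ → Set
  InRange x = (- + δ₁ Γ ℤ.≤ x) × (x ℤ.≤ + δ₁ Γ)

  exactIndex-both : ∀ S → 1 ≤ #A S → 1 ≤ #B S → exactIndex Γ S ≡ margin (#A S) n ⊓ margin (#B S) m
  exactIndex-both S meetsA meetsB = exactIndex-unique Γ S _ alliance⇔
      (ℤP.⊓-glb (proj₁ boundsA) (proj₁ boundsB)) (ℤP.≤-trans (ℤP.i⊓j≤i _ _) (proj₂ boundsA))
    where
    boundsA : InRange (margin (#A S) n)
    boundsA = margin-bounds (#A S) n (δ₁ Γ) (#A≤n S) (meets-B⇒n≤δ₁ S meetsB)
    boundsB : InRange (margin (#B S) m)
    boundsB = margin-bounds (#B S) m (δ₁ Γ) (#B≤m S) (meets-A⇒m≤δ₁ S meetsA)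
    alliance⇔ : ∀ k → isDefAlliance Γ S k ≡ true ⇔ k ℤ.≤ margin (#A S) n ⊓ margin (#B S) m
    alliance⇔ k = Eq.trans (alliance-K S k) (mk⇔
      (λ (fromA , fromB) → ℤP.⊓-glb (fromB meetsB) (fromA meetsA))
      (λ k≤ → (λ _ → ℤP.≤-trans k≤ (ℤP.i⊓j≤j _ _)) , (λ _ → ℤP.≤-trans k≤ (ℤP.i⊓j≤i _ _))))

  exactIndex-onlyA : ∀ S → 1 ≤ #A S → #B S ≡ 0 → exactIndex Γ S ≡ margin 0 m
  exactIndex-onlyA S meetsA missesB = exactIndex-unique Γ S _ alliance⇔
      (proj₁ bounds) (proj₂ bounds)
    where
    bounds : InRange (margin 0 m)
    bounds = margin-bounds 0 m (δ₁ Γ) z≤n (meets-A⇒m≤δ₁ S meetsA)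
    alliance⇔ : ∀ k → isDefAlliance Γ S k ≡ true ⇔ k ℤ.≤ margin 0 m
    alliance⇔ k = Eq.trans (alliance-K S k) (mk⇔
      (λ (fromA , _) → subst (λ b → k ℤ.≤ margin b m) missesB (fromA meetsA))
      (λ k≤ → (λ _ → subst (λ b → k ℤ.≤ margin b m) (sym missesB) k≤) ,
              (λ meetsB → ⊥-elim (ℕP.<⇒≱ meetsB (ℕP.≤-reflexive missesB)))))

  exactIndex-onlyB : ∀ S → #A S ≡ 0 → 1 ≤ #B S → exactIndex Γ S ≡ margin 0 n
  exactIndex-onlyB S missesA meetsB = exactIndex-unique Γ S _ alliance⇔
      (proj₁ bounds) (proj₂ bounds)
    where
    bounds : InRange (margin 0 n)
    bounds = margin-bounds 0 n (δ₁ Γ) z≤n (meets-B⇒n≤δ₁ S meetsB)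
    alliance⇔ : ∀ k → isDefAlliance Γ S k ≡ true ⇔ k ℤ.≤ margin 0 n
    alliance⇔ k = Eq.trans (alliance-K S k) (mk⇔
      (λ (_ , fromB) → subst (λ a → k ℤ.≤ margin a n) missesA (fromB meetsB))
      (λ k≤ → (λ meetsA → ⊥-elim (ℕP.<⇒≱ meetsA (ℕP.≤-reflexive missesA))) ,
              (λ _ → subst (λ a → k ℤ.≤ margin a n) (sym missesA) k≤)))

  -- If S meets both parts, any two of its vertices are joined inside S by a
  -- walk of length ≤ 2: directly when they lie in different parts, and
  -- through a vertex of S in the other part otherwise.
  connected-both : ∀ S → 1 ≤ #A S → 1 ≤ #B S → inducedConnected Γ S ≡ true
  connected-both S meetsA meetsB
    with count-witness (λ u → inA u ∧ S u) meetsA | count-witness (λ u → not (inA u) ∧ S u) meetsB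
  ... | a , a∈S∩A | b , b∈S∩B =
    Connectivity.connected-intro Γ S (ℕP.≤-trans meetsA (subst (#A S ℕ.≤_) (sym (count≡#A+#B S)) (ℕP.m≤m+n _ _)))
      (λ u w su sw → reach-mono {2} {n + m} u w 2≤N (within-two u w su sw))
    where
    open Walks Γ S
    a∈A : inA a ≡ true
    a∈A = proj₁ (∧-elim (inA a) a∈S∩A)
    b∈B : inA b ≡ false
    b∈B = not-true (proj₁ (∧-elim (not (inA b)) b∈S∩B))
    2≤N : 2 ℕ.≤ n + m
    2≤N = subst (2 ℕ.≤_) (count-true {n + m})
            (count-two (λ _ → true) a b refl refl (λ a≡b → true≢false (trans (sym a∈A) (trans (cong inA a≡b) b∈B))))
      where
      true≢false : ¬ true ≡ false
      true≢false ()
    edge : ∀ u w → S u ≡ true → S w ≡ true → adj Γ u w ≡ true → reach Γ S 2 u w ≡ true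
    edge u w su sw uw = reach-suc 1 u w (reach-step 0 u u w (reach-refl u su) sw uw)
    path : ∀ u x w → S u ≡ true → S x ≡ true → S w ≡ true → adj Γ u x ≡ true → adj Γ x w ≡ true →
      reach Γ S 2 u w ≡ true
    path u x w su sx sw ux xw = reach-step 1 u x w (reach-step 0 u u x (reach-refl u su) sx ux) sw xw
    within-two : ∀ u w → S u ≡ true → S w ≡ true → reach Γ S 2 u w ≡ true
    within-two u w su sw = by-parts (inA u) (inA w) refl refl
      where
      by-parts : ∀ x y → inA u ≡ x → inA w ≡ y → reach Γ S 2 u w ≡ true
      by-parts true false u∈ w∈ = edge u w su sw (cong₂ _xor_ u∈ w∈)
      by-parts false true u∈ w∈ = edge u w su sw (cong₂ _xor_ u∈ w∈)
      by-parts true true u∈ w∈ =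
        path u b w su (proj₂ (∧-elim (not (inA b)) b∈S∩B)) sw (cong₂ _xor_ u∈ b∈B) (cong₂ _xor_ b∈B w∈)
      by-parts false false u∈ w∈ =
        path u a w su (proj₂ (∧-elim (inA a) a∈S∩A)) sw (cong₂ _xor_ u∈ a∈A) (cong₂ _xor_ a∈A w∈)

  onlyA-independent : ∀ S → #B S ≡ 0 → Walks.Independent Γ S
  onlyA-independent S missesB u w su sw = cong₂ _xor_ (in-A u su) (in-A w sw)
    where
    in-A : ∀ v → S v ≡ true → inA v ≡ true
    in-A v sv with inA v | count-zero (λ u → not (inA u) ∧ S u) missesB v
    ... | true | _ = refl
    ... | false | v∉S = trans (sym v∉S) sv

  onlyB-independent : ∀ S → #A S ≡ 0 → Walks.Independent Γ S
  onlyB-independent S missesA u w su sw = cong₂ _xor_ (in-B u su) (in-B w sw)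
    where
    in-B : ∀ v → S v ≡ true → inA v ≡ false
    in-B v sv with inA v | count-zero (λ u → inA u ∧ S u) missesA v
    ... | false | _ = refl
    ... | true | v∉S = trans (sym sv) v∉S

  term : ℤ → VSet (n + m) → ℕ
  term e S = 𝟙 (inducedConnected Γ S ∧ does ((+ (n + m) ℤ.+ exactIndex Γ S) ≟ℤ e))

  term-by-sizes : ∀ e S → term e S ≡ contribution n m e (#A S) (#B S)
  term-by-sizes e S = by-sizes (#A S) (#B S) refl refl
    where
    open Connectivity Γ S
    disconnected : inducedConnected Γ S ≡ false → term e S ≡ 0
    disconnected c = cong (λ c → 𝟙 (c ∧ does ((+ (n + m) ℤ.+ exactIndex Γ S) ≟ℤ e))) c
    connected : ∀ {x} → inducedConnected Γ S ≡ true → + (n + m) ℤ.+ exactIndex Γ S ≡ x → term e S ≡ [ x ≟ e ]ℤ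
    connected c x≡ = cong₂ (λ c x → 𝟙 (c ∧ does (x ≟ℤ e))) c x≡
    size : ∀ a b → #A S ≡ a → #B S ≡ b → count S ≡ a + b
    size a b a≡ b≡ = trans (count≡#A+#B S) (cong₂ _+_ a≡ b≡)
    positive : ∀ {c k} → c ≡ suc k → 1 ≤ c
    positive refl = s≤s z≤n
    -- Sizes (0,0): empty.  (0,1), (1,0): a singleton, whose exponent is
    -- n + m + (0 - n) = m, resp. n.  Two or more vertices in one part only:
    -- independent, hence disconnected.  Both parts met: connected, with
    -- k_S = min(2a - n, 2b - m).
    by-sizes : ∀ a b → #A S ≡ a → #B S ≡ b → term e S ≡ contribution n m e a b
    by-sizes zero zero a≡ b≡ = disconnected (empty-disconnected (size 0 0 a≡ b≡))
    by-sizes zero (suc zero) a≡ b≡ = connected (singleton-connected (size 0 1 a≡ b≡))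
      (trans (cong (ℤ._+_ (+ (n + m))) (exactIndex-onlyB S a≡ (positive b≡)))
             (trans (cong (ℤ._+ margin 0 n) (ℤP.pos-+ n m)) (solve (+ n) (+ m))))
      where
      solve : ∀ (a b : ℤ) → (a ℤ.+ b) ℤ.+ (+ 0 ℤ.- a) ≡ b
      solve = solve-∀
    by-sizes zero (suc (suc b)) a≡ b≡ = disconnected (independent-disconnected (onlyB-independent S a≡)
      (subst (2 ≤_) (sym (size 0 (suc (suc b)) a≡ b≡)) (s≤s (s≤s z≤n))))
    by-sizes (suc zero) zero a≡ b≡ = connected (singleton-connected (size 1 0 a≡ b≡))
      (trans (cong (ℤ._+_ (+ (n + m))) (exactIndex-onlyA S (positive a≡) b≡))
             (trans (cong (ℤ._+ margin 0 m) (ℤP.pos-+ n m)) (solve (+ n) (+ m))))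
      where
      solve : ∀ (a b : ℤ) → (a ℤ.+ b) ℤ.+ (+ 0 ℤ.- b) ≡ a
      solve = solve-∀
    by-sizes (suc (suc a)) zero a≡ b≡ = disconnected (independent-disconnected (onlyA-independent S b≡)
      (subst (2 ≤_) (sym (size (suc (suc a)) 0 a≡ b≡)) (s≤s (s≤s z≤n))))
    by-sizes (suc a) (suc b) a≡ b≡ = connected (connected-both S (positive a≡) (positive b≡))
      (cong (ℤ._+_ (+ (n + m))) (trans (exactIndex-both S (positive a≡) (positive b≡))
        (cong₂ (λ a b → margin a n ⊓ margin b m) a≡ b≡)))

module Rearrangement (n′ m′ : ℕ) (e : ℤ) where

  n m : ℕ
  n = suc n′
  m = suc m′

  weighted : ℕ → ℕ → ℕ
  weighted i j = (n C i) * (m C j) * contribution n m e i j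

  block : ℕ → ℕ → ℕ
  block a b = weighted (suc a) (suc b)

  statementTerm : ℕ → ℕ → ℕ
  statementTerm i j = (n C i) * (m C j) * [ + (n + m) ℤ.+ (margin i n ⊓ margin j m) ≟ e ]ℤ

  statementSum : ℕ
  statementSum = sum (map (λ k → sum (map (λ i → statementTerm i (k ∸ i)) (range 1 (k ∸ 1)))) (range 2 (n + m)))

  double-binomial : binomialSum n (λ i → binomialSum m (contribution n m e i)) ≡ ∑[ i < suc n ] ∑[ j < suc m ] weighted i j
  double-binomial =
    trans (binomialSum-closed n (λ i → binomialSum m (contribution n m e i))) (sumBelow-cong (suc n) (λ i _ →
      trans (cong ((n C i) *_) (binomialSum-closed m (contribution n m e i)))
        (trans (sumBelow-*ˡ (suc m) (n C i) (λ j → (m C j) * contribution n m e i j))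
          (sumBelow-cong (suc m) (λ j _ → sym (ℕP.*-assoc (n C i) (m C j) (contribution n m e i j)))))))

  -- Only the singletons of B survive in the row i = 0.
  first-row : ∑[ j < suc m ] weighted 0 j ≡ m * [ + m ≟ e ]ℤ
  first-row = begin
      weighted 0 0 + (weighted 0 1 + ∑[ j < m′ ] weighted 0 (suc (suc j)))
    ≡⟨ cong₂ _+_ (ℕP.*-zeroʳ ((n C 0) * (m C 0)))
         (cong₂ _+_ (cong (_* [ + m ≟ e ]ℤ) (trans (ℕP.*-identityˡ (m C 1)) (nC1≡n m)))
                    (sumBelow-zero m′ (λ j _ → ℕP.*-zeroʳ ((n C 0) * (m C suc (suc j)))))) ⟩
      m * [ + m ≟ e ]ℤ + 0
    ≡⟨ +-identityʳ _ ⟩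
      m * [ + m ≟ e ]ℤ
    ∎
    where open ≡-Reasoning

  -- Only the singletons of A survive in the column j = 0.
  first-column : ∑[ i < n ] weighted (suc i) 0 ≡ n * [ + n ≟ e ]ℤ
  first-column = trans
    (cong₂ _+_ (cong (_* [ + n ≟ e ]ℤ) (trans (ℕP.*-identityʳ (n C 1)) (nC1≡n n)))
               (sumBelow-zero n′ (λ i _ → ℕP.*-zeroʳ ((n C suc (suc i)) * (m C 0)))))
    (+-identityʳ _)

  block-vanishes-A : ∀ a b → n ℕ.≤ a → block a b ≡ 0
  block-vanishes-A a b n≤a rewrite k>n⇒nCk≡0 {n} {suc a} (s≤s n≤a) = refl

  block-vanishes-B : ∀ a b → m ℕ.≤ b → block a b ≡ 0
  block-vanishes-B a b m≤b rewrite k>n⇒nCk≡0 {m} {suc b} (s≤s m≤b) | ℕP.*-zeroʳ (n C suc a) = refl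

  -- With k = k′ + 2 and i = i′ + 1 the statement sums the anti-diagonals of
  -- the block, k′ < n + m - 1.
  statementSum-antidiagonals : statementSum ≡ ∑[ k < n′ + m ] ∑[ i < suc k ] block i (k ∸ i)
  statementSum-antidiagonals =
    trans (cong sum (sym (map-∘ (upTo (n′ + m)))))
      (trans (sum-applyUpTo _ (λ x → x) (n′ + m))
        (sumBelow-cong (n′ + m) (λ k _ →
          trans (cong sum (sym (map-∘ (upTo (suc k)))))
            (trans (sum-applyUpTo _ (λ x → x) (suc k))
              (sumBelow-cong (suc k) (λ i i≤k → cong (statementTerm (suc i)) (ℕP.+-∸-assoc 1 (≤-pred i≤k))))))))

  -- The triangle a + b < n + m - 1 contains the rectangle a < n, b < m, and
  -- the block vanishes outside that rectangle.
  triangle≡rectangle : ∑[ a < n′ + m ] sumBelow (n′ + m ∸ a) (block a) ≡ ∑[ a < n ] ∑[ b < m ] block a b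
  triangle≡rectangle =
    trans (sumBelow-cong (n′ + m) row)
          (sumBelow-truncate (n′ + m) n (λ a → ∑[ b < m ] block a b) n≤n′+m
            (λ a n≤a → sumBelow-zero m (λ b _ → block-vanishes-A a b n≤a)))
    where
    n≤n′+m : n ℕ.≤ n′ + m
    n≤n′+m = subst (n ℕ.≤_) (sym (+-suc n′ m′)) (s≤s (ℕP.m≤m+n n′ m′))
    row : ∀ a → a < n′ + m → sumBelow (n′ + m ∸ a) (block a) ≡ ∑[ b < m ] block a b
    row a _ with a ℕP.<? n
    ... | yes (s≤s a≤n′) = sumBelow-truncate (n′ + m ∸ a) m (block a)
            (subst (ℕ._≤ n′ + m ∸ a) (ℕP.m+n∸m≡n a m) (ℕP.∸-monoˡ-≤ a (ℕP.+-monoˡ-≤ m a≤n′)))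
            (block-vanishes-B a)
    ... | no a≮n = trans (sumBelow-zero (n′ + m ∸ a) (λ b _ → block-vanishes-A a b (ℕP.≮⇒≥ a≮n)))
                         (sym (sumBelow-zero m (λ b _ → block-vanishes-A a b (ℕP.≮⇒≥ a≮n))))

  double-binomial≡rhs : binomialSum n (λ i → binomialSum m (contribution n m e i)) ≡ rhsCoeff n m e
  double-binomial≡rhs = begin
      binomialSum n (λ i → binomialSum m (contribution n m e i))
    ≡⟨ double-binomial ⟩
      ∑[ j < suc m ] weighted 0 j + ∑[ i < n ] (weighted (suc i) 0 + ∑[ b < m ] block i b)
    ≡⟨ cong (_+_ (∑[ j < suc m ] weighted 0 j)) (sumBelow-+ n (λ i → weighted (suc i) 0) (λ i → ∑[ b < m ] block i b)) ⟩
      ∑[ j < suc m ] weighted 0 j + (∑[ i < n ] weighted (suc i) 0 + ∑[ a < n ] ∑[ b < m ] block a b)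
    ≡⟨ cong₂ (λ x y → x + (y + ∑[ a < n ] ∑[ b < m ] block a b)) first-row first-column ⟩
      m * [ + m ≟ e ]ℤ + (n * [ + n ≟ e ]ℤ + ∑[ a < n ] ∑[ b < m ] block a b)
    ≡⟨ cong (λ x → m * [ + m ≟ e ]ℤ + (n * [ + n ≟ e ]ℤ + x)) rectangle≡statementSum ⟩
      m * [ + m ≟ e ]ℤ + (n * [ + n ≟ e ]ℤ + statementSum)
    ≡⟨ swap-front (m * [ + m ≟ e ]ℤ) (n * [ + n ≟ e ]ℤ) statementSum ⟩
      rhsCoeff n m e
    ∎
    where
    open ≡-Reasoning
    rectangle≡statementSum : ∑[ a < n ] ∑[ b < m ] block a b ≡ statementSum
    rectangle≡statementSum =
      sym (trans statementSum-antidiagonals (trans (antidiagonals (n′ + m) block) triangle≡rectangle))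
    swap-front : ∀ x y z → x + (y + z) ≡ y + x + z
    swap-front x y z = trans (sym (+-assoc x y z)) (cong (_+ z) (+-comm x y))

proposition3p13 : (n m : ℕ) → n ≥ 1 → m ≥ 1 →
    (e : ℤ) → allianceCoeff (K n m) e ≡ rhsCoeff n m e
proposition3p13 (suc n′) (suc m′) _ _ e = begin
    allianceCoeff (K n m) e
  ≡⟨ length-filter (λ S → inducedConnected (K n m) S ∧ does ((+ (n + m) ℤ.+ exactIndex (K n m) S) ≟ℤ e))
                   (allSubsets (n + m)) ⟩
    sum (map (term e) (allSubsets (n + m)))
  ≡⟨ sum-map-cong (allSubsets (n + m)) (term-by-sizes e) ⟩
    sum (map (λ S → contribution n m e (sizeA n m S) (sizeB n m S)) (allSubsets (n + m)))
  ≡⟨ sum-subsets-by-parts n m (contribution n m e) ⟩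
    binomialSum n (λ i → binomialSum m (contribution n m e i))
  ≡⟨ Rearrangement.double-binomial≡rhs n′ m′ e ⟩
    rhsCoeff n m e
  ∎
  where
  open ≡-Reasoning
  n m : ℕ
  n = suc n′
  m = suc m′
  open Bipartite n m using (term; term-by-sizes)
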